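{- There is no family $\{\Gamma_i: i\in\mathbb{N}\}$ of spanning subgraphs of the countably infinite complete graph $K_{\mathbb{N}}$, each isomorphic to $S_1$, whose edge sets partition $E(K_{\mathbb{N}})$.
   Context: $S_1$ (the countable star) is the graph with vertex set $\mathbb{N}=\{0,1,2,\dots\}$ and edges $\{0,i\}$ for all $i\ge1$. -}

module Defs where

open import Data.Nat using (ℕ; zero; suc; _≥_)
open import Data.Product using (Σ; ∃; _×_)
open import Data.Sum using (_⊎_)
open import Relation.Nullary using (¬_)
open import Relation.Binary.PropositionalEquality using (_≡_; _≢_)
open import Function.Bundles using (Bijection; _⤖_; _⇔_)

-- A simple graph on the vertex set ℕ, given by a symmetric irreflexive
-- adjacency relation.  Every such graph is a spanning subgraph of K_ℕ
-- (whose edges are all pairs {x,y} with x ≢ y).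
record Graph : Set₁ where
  field
    Adj    : ℕ → ℕ → Set
    sym    : ∀ {x y} → Adj x y → Adj y x
    irrefl : ∀ {x} → ¬ Adj x x
open Graph public

S₁Adj : ℕ → ℕ → Set
S₁Adj x y = (x ≡ 0 × y ≥ 1) ⊎ (y ≡ 0 × x ≥ 1)

IsoToS₁ : Graph → Set
IsoToS₁ G = Σ (ℕ ⤖ ℕ) λ f →
  ∀ x y → S₁Adj x y ⇔ Adj G (Bijection.to f x) (Bijection.to f y)

PartitionsEdges : (ℕ → Graph) → Set
PartitionsEdges Γ = ∀ x y → x ≢ y →
  (∃ λ i → Adj (Γ i) x y) × (∀ i j → Adj (Γ i) x y → Adj (Γ j) x y → i ≡ j)

{-# OPTIONS --safe #-}
module Submission where

-- The centre of a spanning star is adjacent to every other vertex, so any two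
-- spanning stars share an edge: the edge joining their centres if these differ,
-- and otherwise any edge at the common centre. That edge would lie in two
-- distinct members of the family, contradicting the partition property.

open import Defs
open import Data.Empty using (⊥-elim)
open import Data.Nat using (ℕ; suc; s≤s; z≤n)
open import Data.Nat.Properties using (_≟_; 1+n≢n; 0≢1+n)
open import Data.Product using (Σ; ∃₂; _×_; _,_; proj₂)
open import Data.Sum using (inj₁)
open import Relation.Nullary using (¬_; yes; no)
open import Relation.Binary.PropositionalEquality using (_≢_; refl; ≢-sym)
open import Function.Bundles using (Bijection; Equivalence)

Dominating : Graph → ℕ → Set
Dominating G c = ∀ v → v ≢ c → Adj G c v

centre : ∀ G → IsoToS₁ G → ℕ
centre _ (f , _) = Bijection.to f 0

centre-dominating : ∀ G (iso : IsoToS₁ G) → Dominating G (centre G iso)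
centre-dominating G (f , preserves) v v≢centre with Bijection.strictlySurjective f v
... | 0     , refl = ⊥-elim (v≢centre refl)
... | suc u , refl = Equivalence.to (preserves 0 (suc u)) (inj₁ (refl , s≤s z≤n))

SharedEdge : Graph → Graph → Set
SharedEdge G H = ∃₂ λ x y → x ≢ y × Adj G x y × Adj H x y

dominating⇒sharedEdge : ∀ G H {c d} → Dominating G c → Dominating H d → SharedEdge G H
dominating⇒sharedEdge G H {c} {d} domG domH with c ≟ d
... | yes refl = c , suc c , ≢-sym 1+n≢n , domG (suc c) 1+n≢n , domH (suc c) 1+n≢n
... | no c≢d   = c , d , c≢d , domG d (≢-sym c≢d) , Graph.sym H (domH c c≢d)

proposition4p1 : ¬ (Σ (ℕ → Graph) λ Γ → ((i : ℕ) → IsoToS₁ (Γ i)) × PartitionsEdges Γ)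
proposition4p1 (Γ , iso , partition)
  with dominating⇒sharedEdge (Γ 0) (Γ 1)
         (centre-dominating (Γ 0) (iso 0)) (centre-dominating (Γ 1) (iso 1))
... | x , y , x≢y , inΓ₀ , inΓ₁ = 0≢1+n (proj₂ (partition x y x≢y) 0 1 inΓ₀ inΓ₁)
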